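{- For $p=011$, we have $$C_p(x,y)=\frac{1-2x+2x^2-x^3+x^3y}{(1-x)^3}.$$
   Context: A Catalan word of length $n\geq 1$ is a word $w_1\ldots w_n$ over the non-negative integers with $w_1=0$ and $0\leq w_i\leq w_{i-1}+1$ for $2\leq i\leq n$; the empty word is the unique Catalan word of length $0$. A word $w$ contains the pattern $p=p_1\ldots p_k$ if there are indices $i_1<\cdots<i_k$ such that $w_{i_1}\ldots w_{i_k}$ is order-isomorphic to $p$ (for all $a,b$: $w_{i_a}<w_{i_b}$ iff $p_a<p_b$, and $w_{i_a}=w_{i_b}$ iff $p_a=p_b$); otherwise $w$ avoids $p$. $\mathcal{C}_n(p)$ is the set of Catalan words of length $n$ avoiding $p$. A descent of $w$ is an index $i$ with $w_i>w_{i+1}$. $C_p(x,y)=\sum_{n,k\geq 0}c_{n,k}x^ny^k$, where $c_{n,k}$ is the number of words in $\mathcal{C}_n(p)$ with exactly $k$ descents. -}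

module Defs where

open import Data.Bool using (Bool; true; false; _∧_; _∨_; not; if_then_else_)
open import Data.Nat using (ℕ; zero; suc; _≤ᵇ_; _<ᵇ_; _≡ᵇ_)
open import Data.List using (List; []; _∷_; map; _++_; concatMap; length; upTo)
open import Data.Integer using (ℤ; +_; -_; _-_) renaming (_+_ to _+ℤ_; _*_ to _*ℤ_)

catalanTail : ℕ → List ℕ → Bool
catalanTail prev [] = true
catalanTail prev (x ∷ xs) = (x ≤ᵇ suc prev) ∧ catalanTail x xs

isCatalan : List ℕ → Bool
isCatalan [] = true
isCatalan (zero ∷ xs) = catalanTail zero xs
isCatalan (suc _ ∷ xs) = false

wordsOver : ℕ → ℕ → List (List ℕ)
wordsOver b zero = [] ∷ []
wordsOver b (suc n) = concatMap (λ a → map (a ∷_) (wordsOver b n)) (upTo b)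

-- Catalan words of length n have letters ≤ n-1 < n, so filtering the words
-- over {0,…,n-1} of length n enumerates 𝒞_n exactly once each.
candidates : ℕ → List (List ℕ)
candidates n = wordsOver n n

subseqs : List ℕ → List (List ℕ)
subseqs [] = [] ∷ []
subseqs (x ∷ xs) = map (x ∷_) (subseqs xs) ++ subseqs xs

cmpℕ : ℕ → ℕ → ℕ
cmpℕ m n = if m <ᵇ n then 0 else (if n <ᵇ m then 2 else 1)

sameOrderWith : ℕ → ℕ → List ℕ → List ℕ → Bool
sameOrderWith a b [] [] = true
sameOrderWith a b (u ∷ us) (v ∷ vs) = (cmpℕ a u ≡ᵇ cmpℕ b v) ∧ (cmpℕ u a ≡ᵇ cmpℕ v b) ∧ sameOrderWith a b us vs
sameOrderWith a b _ _ = false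

orderIso : List ℕ → List ℕ → Bool
orderIso [] [] = true
orderIso (u ∷ us) (v ∷ vs) = sameOrderWith u v us vs ∧ orderIso us vs
orderIso _ _ = false

anyᵇ : {A : Set} → (A → Bool) → List A → Bool
anyᵇ f [] = false
anyᵇ f (x ∷ xs) = f x ∨ anyᵇ f xs

contains : List ℕ → List ℕ → Bool
contains w p = anyᵇ (λ s → orderIso s p) (subseqs w)

avoids : List ℕ → List ℕ → Bool
avoids w p = not (contains w p)

descents : List ℕ → ℕ
descents [] = 0
descents (x ∷ []) = 0
descents (x ∷ y ∷ ys) = (if y <ᵇ x then 1 else 0) Data.Nat.+ descents (y ∷ ys)

countᵇ : {A : Set} → (A → Bool) → List A → ℕ
countᵇ f [] = 0
countᵇ f (x ∷ xs) = (if f x then 1 else 0) Data.Nat.+ countᵇ f xs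

cnk : List ℕ → ℕ → ℕ → ℕ
cnk p n k = countᵇ (λ w → isCatalan w ∧ avoids w p ∧ (descents w ≡ᵇ k)) (candidates n)

Series : Set
Series = ℕ → ℕ → ℤ

-- C_p(x,y) = Σ c_{n,k} xⁿ yᵏ
Cgf : List ℕ → Series
Cgf p n k = + cnk p n k

shiftX : ℕ → Series → Series
shiftX j F n k = if j ≤ᵇ n then F (n Data.Nat.∸ j) k else + 0

times1mx³ : Series → Series
times1mx³ F n k = F n k - (+ 3) *ℤ shiftX 1 F n k +ℤ (+ 3) *ℤ shiftX 2 F n k - shiftX 3 F n k

numer : Series
numer 0 0 = + 1
numer 1 0 = - (+ 2)
numer 2 0 = + 2
numer 3 0 = - (+ 1)
numer 3 1 = + 1
numer _ _ = + 0

p011 : List ℕ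
p011 = 0 ∷ 1 ∷ 1 ∷ []

-- A Catalan word avoiding 011 never repeats a positive letter after a 0, and a descent
-- can only go back to 0 (any other target value reappears after the initial 0).
-- So the avoiders are exactly 0^a 1 2 ⋯ m 0^b with a ≥ 1, having one descent when
-- m, b ≥ 1 and none when b = 0.  Hence c_{n,0} = n and c_{n,1} = binom(n-1, 2) for
-- n ≥ 1: both are polynomials of degree ≤ 2 in n, so (1 - x)^3 C_{011}(x, y) is a
-- polynomial, whose few coefficients are computed directly.
module Submission where

open import Data.Bool using (Bool; true; false; _∧_; _∨_; not; if_then_else_)
open import Data.Bool.Properties using (∧-zeroʳ; ∨-identityʳ; ∨-assoc; ∨-zeroʳ; ∧-distribˡ-∨; T-≡)
open import Data.Empty using (⊥-elim)
open import Data.Integer using (+_; _-_) renaming (_+_ to _+ℤ_; _*_ to _*ℤ_)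
open import Data.Integer.Properties using (pos-+; pos-*; +-inverseʳ)
open import Data.Integer.Solver using (module +-*-Solver)
open import Data.List using (List; []; _∷_; map; _++_; length; concatMap; applyUpTo)
open import Data.Nat using (ℕ; zero; suc; pred; _+_; _*_; _∸_; _≤_; _<_; s≤s; z≤n; _≤ᵇ_; _<ᵇ_; _≡ᵇ_)
open import Data.Nat.Properties
  using (<-cmp; <⇒<ᵇ; <⇒≤; <⇒≢; <⇒≱; ≤-refl; ≤-trans; ≤-pred; n≤1+n; m≤m+n; +-identityʳ; +-assoc; +-comm; +-suc)
open import Data.Nat.ListAction using (sum)
import Data.Nat.Solver as ℕ-Solver
open import Function using (_∘_; Equivalence)
open import Relation.Binary using (tri<; tri≈; tri>)
open import Relation.Binary.PropositionalEquality

open import Defs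

≡ᵇ-refl : ∀ n → (n ≡ᵇ n) ≡ true
≡ᵇ-refl zero = refl
≡ᵇ-refl (suc n) = ≡ᵇ-refl n

≢⇒≡ᵇ≡false : ∀ {m n} → m ≢ n → (m ≡ᵇ n) ≡ false
≢⇒≡ᵇ≡false {zero} {zero} m≢n = ⊥-elim (m≢n refl)
≢⇒≡ᵇ≡false {zero} {suc n} _ = refl
≢⇒≡ᵇ≡false {suc m} {zero} _ = refl
≢⇒≡ᵇ≡false {suc m} {suc n} m≢n = ≢⇒≡ᵇ≡false (m≢n ∘ cong suc)

<⇒<ᵇ≡true : ∀ {m n} → m < n → (m <ᵇ n) ≡ true
<⇒<ᵇ≡true = Equivalence.to T-≡ ∘ <⇒<ᵇ

≤⇒<ᵇ≡false : ∀ {m n} → n ≤ m → (m <ᵇ n) ≡ false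
≤⇒<ᵇ≡false {m} {zero} _ = refl
≤⇒<ᵇ≡false {suc m} {suc n} (s≤s n≤m) = ≤⇒<ᵇ≡false n≤m

cmpℕ-< : ∀ {m n} → m < n → cmpℕ m n ≡ 0
cmpℕ-< m<n rewrite <⇒<ᵇ≡true m<n = refl

cmpℕ-≡ : ∀ n → cmpℕ n n ≡ 1
cmpℕ-≡ n rewrite ≤⇒<ᵇ≡false (≤-refl {n}) = refl

cmpℕ-> : ∀ {m n} → n < m → cmpℕ m n ≡ 2
cmpℕ-> n<m rewrite ≤⇒<ᵇ≡false (<⇒≤ n<m) | <⇒<ᵇ≡true n<m = refl

orderIso-length : ∀ u v → length u ≢ length v → orderIso u v ≡ false
orderIso-length [] [] ≢ = ⊥-elim (≢ refl)
orderIso-length [] (_ ∷ _) _ = refl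
orderIso-length (_ ∷ _) [] _ = refl
orderIso-length (u ∷ us) (v ∷ vs) ≢ rewrite orderIso-length us vs (≢ ∘ cong suc) = ∧-zeroʳ _

orderIso-011 : ∀ x y z → orderIso (x ∷ y ∷ z ∷ []) p011 ≡ (x <ᵇ y) ∧ (y ≡ᵇ z)
orderIso-011 x y z with <-cmp x y
... | tri> _ _ y<x rewrite cmpℕ-> y<x | ≤⇒<ᵇ≡false (<⇒≤ y<x) = refl
... | tri≈ _ refl _ rewrite cmpℕ-≡ x | ≤⇒<ᵇ≡false (≤-refl {x}) = refl
... | tri< x<y _ _ rewrite cmpℕ-< x<y | cmpℕ-> x<y | <⇒<ᵇ≡true x<y with <-cmp y z
...   | tri< y<z _ _ rewrite cmpℕ-< (≤-trans x<y (<⇒≤ y<z)) | cmpℕ-> (≤-trans x<y (<⇒≤ y<z))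
                           | cmpℕ-< y<z | ≢⇒≡ᵇ≡false (<⇒≢ y<z) = refl
...   | tri≈ _ refl _ rewrite cmpℕ-< x<y | cmpℕ-> x<y | cmpℕ-≡ y | ≡ᵇ-refl y = refl
...   | tri> _ _ z<y rewrite cmpℕ-> z<y | ≢⇒≡ᵇ≡false (<⇒≢ z<y ∘ sym) with <-cmp x z
...     | tri< x<z _ _ rewrite cmpℕ-< x<z | cmpℕ-> x<z = refl
...     | tri≈ _ refl _ rewrite cmpℕ-≡ x = refl
...     | tri> _ _ z<x rewrite cmpℕ-> z<x = refl

elemᵇ : ℕ → List ℕ → Bool
elemᵇ y = anyᵇ (y ≡ᵇ_)

repeatsAbove : ℕ → List ℕ → Bool
repeatsAbove x [] = false
repeatsAbove x (y ∷ ys) = ((x <ᵇ y) ∧ elemᵇ y ys) ∨ repeatsAbove x ys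

has011 : List ℕ → Bool
has011 [] = false
has011 (x ∷ xs) = repeatsAbove x xs ∨ has011 xs

anyᵇ-++ : ∀ {A : Set} (f : A → Bool) xs ys → anyᵇ f (xs ++ ys) ≡ anyᵇ f xs ∨ anyᵇ f ys
anyᵇ-++ f [] ys = refl
anyᵇ-++ f (x ∷ xs) ys rewrite anyᵇ-++ f xs ys = sym (∨-assoc (f x) (anyᵇ f xs) (anyᵇ f ys))

anyᵇ-map : ∀ {A B : Set} (f : B → Bool) (g : A → B) xs → anyᵇ f (map g xs) ≡ anyᵇ (f ∘ g) xs
anyᵇ-map f g [] = refl
anyᵇ-map f g (x ∷ xs) rewrite anyᵇ-map f g xs = refl

anyᵇ-const-false : ∀ {A : Set} (xs : List A) → anyᵇ (λ _ → false) xs ≡ false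
anyᵇ-const-false [] = refl
anyᵇ-const-false (_ ∷ xs) = anyᵇ-const-false xs

anyᵇ-subseqs-∷ : ∀ (f : List ℕ → Bool) x xs →
  anyᵇ f (subseqs (x ∷ xs)) ≡ anyᵇ (f ∘ (x ∷_)) (subseqs xs) ∨ anyᵇ f (subseqs xs)
anyᵇ-subseqs-∷ f x xs
  rewrite anyᵇ-++ f (map (x ∷_) (subseqs xs)) (subseqs xs) | anyᵇ-map f (x ∷_) (subseqs xs) = refl

anyᵇ-subseqs-only-[] : ∀ (f : List ℕ → Bool) → (∀ a s → f (a ∷ s) ≡ false) →
  ∀ xs → anyᵇ f (subseqs xs) ≡ f []
anyᵇ-subseqs-only-[] f f∷≡false [] = ∨-identityʳ (f [])
anyᵇ-subseqs-only-[] f f∷≡false (x ∷ xs) rewrite anyᵇ-subseqs-∷ f x xs = begin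
  anyᵇ (f ∘ (x ∷_)) (subseqs xs) ∨ anyᵇ f (subseqs xs)
    ≡⟨ cong₂ _∨_ (trans (anyᵇ-cong (subseqs xs)) (anyᵇ-const-false (subseqs xs)))
                 (anyᵇ-subseqs-only-[] f f∷≡false xs) ⟩
  f [] ∎
  where
  open ≡-Reasoning
  anyᵇ-cong : ∀ ss → anyᵇ (f ∘ (x ∷_)) ss ≡ anyᵇ (λ _ → false) ss
  anyᵇ-cong [] = refl
  anyᵇ-cong (s ∷ ss) rewrite f∷≡false x s | anyᵇ-cong ss = refl

contains-011-from-pair : ∀ x y zs →
  anyᵇ (λ s → orderIso (x ∷ y ∷ s) p011) (subseqs zs) ≡ (x <ᵇ y) ∧ elemᵇ y zs
contains-011-from-pair x y [] rewrite orderIso-length (x ∷ y ∷ []) p011 (λ ()) = sym (∧-zeroʳ (x <ᵇ y))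
contains-011-from-pair x y (z ∷ zs)
  rewrite anyᵇ-subseqs-∷ (λ s → orderIso (x ∷ y ∷ s) p011) z zs
        | anyᵇ-subseqs-only-[] (λ s → orderIso (x ∷ y ∷ z ∷ s) p011)
            (λ a s → orderIso-length (x ∷ y ∷ z ∷ a ∷ s) p011 (λ ())) zs
        | orderIso-011 x y z | contains-011-from-pair x y zs
  = sym (∧-distribˡ-∨ (x <ᵇ y) (y ≡ᵇ z) (elemᵇ y zs))

contains-011-from : ∀ x xs → anyᵇ (λ s → orderIso (x ∷ s) p011) (subseqs xs) ≡ repeatsAbove x xs
contains-011-from x [] = refl
contains-011-from x (y ∷ ys)
  rewrite anyᵇ-subseqs-∷ (λ s → orderIso (x ∷ s) p011) y ys
        | contains-011-from-pair x y ys | contains-011-from x ys = refl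

contains-011 : ∀ w → contains w p011 ≡ has011 w
contains-011 [] = refl
contains-011 (x ∷ xs)
  rewrite anyᵇ-subseqs-∷ (λ s → orderIso s p011) x xs
        | contains-011-from x xs | contains-011 xs = refl

-- Each state is named after the prefix read so far: 0^a, 0^a 1⋯m, 0^a 1⋯m 0^b (a, m, b ≥ 1).
afterDrop : ℕ → List ℕ → Bool
afterDrop k [] = 1 ≡ᵇ k
afterDrop k (zero ∷ w) = afterDrop k w
afterDrop k (suc _ ∷ w) = false

afterAscent : ℕ → ℕ → List ℕ → Bool
afterAscent m k [] = 0 ≡ᵇ k
afterAscent m k (zero ∷ w) = afterDrop k w
afterAscent m k (suc x ∷ w) = if x ≡ᵇ m then afterAscent (suc m) k w else false

afterZeros : ℕ → List ℕ → Bool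
afterZeros k [] = 0 ≡ᵇ k
afterZeros k (zero ∷ w) = afterZeros k w
afterZeros k (suc zero ∷ w) = afterAscent 1 k w
afterZeros k (suc (suc _) ∷ w) = false

avoider : ℕ → List ℕ → Bool
avoider k [] = 0 ≡ᵇ k
avoider k (zero ∷ w) = afterZeros k w
avoider k (suc _ ∷ w) = false

revisits : ℕ → List ℕ → Bool
revisits zero w = false
revisits (suc m) w = revisits m w ∨ elemᵇ (suc m) w

revisits-[] : ∀ m → revisits m [] ≡ false
revisits-[] zero = refl
revisits-[] (suc m) rewrite revisits-[] m = refl

revisits-0∷ : ∀ m w → revisits m (0 ∷ w) ≡ revisits m w
revisits-0∷ zero w = refl
revisits-0∷ (suc m) w rewrite revisits-0∷ m w = refl

revisits-above : ∀ m x w → m < x → revisits m (x ∷ w) ≡ revisits m w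
revisits-above zero x w _ = refl
revisits-above (suc m) x w m<x
  rewrite revisits-above m x w (≤-trans (n≤1+n (suc m)) m<x) | ≢⇒≡ᵇ≡false (<⇒≢ m<x) = refl

revisits-hit : ∀ m x w → 1 ≤ x → x ≤ m → revisits m (x ∷ w) ≡ true
revisits-hit zero x w 1≤x x≤0 = ⊥-elim (<⇒≱ 1≤x x≤0)
revisits-hit (suc m) x w 1≤x x≤m with <-cmp x (suc m)
... | tri< x<m _ _ rewrite revisits-hit m x w 1≤x (≤-pred x<m) = refl
... | tri≈ _ refl _ rewrite ≡ᵇ-refl (suc m) = ∨-zeroʳ (revisits m (suc m ∷ w))
... | tri> _ _ m<x = ⊥-elim (<⇒≱ m<x x≤m)

repeatsAbove⇒repeatsAbove-0 : ∀ x w → repeatsAbove x w ≡ true → repeatsAbove 0 w ≡ true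
repeatsAbove⇒repeatsAbove-0 x (zero ∷ ys) rep
  rewrite ≤⇒<ᵇ≡false {x} {0} z≤n = repeatsAbove⇒repeatsAbove-0 x ys rep
repeatsAbove⇒repeatsAbove-0 x (suc y ∷ ys) rep with elemᵇ (suc y) ys
... | true = refl
... | false rewrite ∧-zeroʳ (x <ᵇ suc y) = repeatsAbove⇒repeatsAbove-0 x ys rep

∨-dup : ∀ h c → h ∨ (h ∨ c) ≡ h ∨ c
∨-dup true c = refl
∨-dup false c = refl

∨-regroup : ∀ o e h h′ c → (h′ ≡ true → h ≡ true) → o ∨ ((e ∨ h) ∨ (h′ ∨ c)) ≡ (o ∨ e) ∨ (h ∨ c)
∨-regroup true e h h′ c _ = refl
∨-regroup false true h h′ c _ = refl
∨-regroup false false true h′ c _ = refl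
∨-regroup false false false false c _ = refl
∨-regroup false false false true c h′⇒h with h′⇒h refl
... | ()

-- After 0^a 1⋯(m+1), an occurrence of 011 in the whole word lies in the remainder w, or
-- starts in the prefix and then is a repeated letter of w above 0, or a letter in {1,…,m+1}.
afterDrop-correct : ∀ m k w →
  catalanTail 0 w ∧ not (revisits (suc m) w ∨ repeatsAbove 0 w ∨ has011 w)
    ∧ (suc (descents (0 ∷ w)) ≡ᵇ k)
  ≡ afterDrop k w
afterDrop-correct m k [] rewrite revisits-[] m = refl
afterDrop-correct m k (zero ∷ w)
  rewrite revisits-0∷ (suc m) w | ∨-dup (repeatsAbove 0 w) (has011 w) = afterDrop-correct m k w
afterDrop-correct m k (suc zero ∷ w)
  rewrite revisits-hit (suc m) 1 w (s≤s z≤n) (s≤s z≤n) = ∧-zeroʳ (catalanTail 1 w)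
afterDrop-correct m k (suc (suc x) ∷ w) = refl

afterAscent-correct : ∀ m k w →
  catalanTail (suc m) w ∧ not (revisits (suc m) w ∨ repeatsAbove 0 w ∨ has011 w)
    ∧ (descents (suc m ∷ w) ≡ᵇ k)
  ≡ afterAscent (suc m) k w
afterAscent-correct m k [] rewrite revisits-[] m = refl
afterAscent-correct m k (zero ∷ w)
  rewrite revisits-0∷ (suc m) w | ∨-dup (repeatsAbove 0 w) (has011 w) = afterDrop-correct m k w
afterAscent-correct m k (suc x ∷ w) with <-cmp x (suc m)
... | tri< x<m _ _
  rewrite revisits-hit (suc m) (suc x) w (s≤s z≤n) x<m | ≢⇒≡ᵇ≡false (<⇒≢ x<m)
  = ∧-zeroʳ ((x <ᵇ suc (suc m)) ∧ catalanTail (suc x) w)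
... | tri> _ _ m<x rewrite ≢⇒≡ᵇ≡false (<⇒≢ m<x ∘ sym) | ≤⇒<ᵇ≡false {x} {suc (suc m)} m<x = refl
... | tri≈ _ refl _
  rewrite ≡ᵇ-refl (suc m) | <⇒<ᵇ≡true (≤-refl {suc (suc m)})
        | revisits-above (suc m) (suc (suc m)) w ≤-refl | ≤⇒<ᵇ≡false (n≤1+n (suc m))
        | ∨-regroup (revisits (suc m) w) (elemᵇ (suc (suc m)) w) (repeatsAbove 0 w)
            (repeatsAbove (suc (suc m)) w) (has011 w) (repeatsAbove⇒repeatsAbove-0 (suc (suc m)) w)
  = afterAscent-correct (suc m) k w

afterZeros-correct : ∀ k w →
  catalanTail 0 w ∧ not (repeatsAbove 0 w ∨ has011 w) ∧ (descents (0 ∷ w) ≡ᵇ k)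
  ≡ afterZeros k w
afterZeros-correct k [] = refl
afterZeros-correct k (zero ∷ w) rewrite ∨-dup (repeatsAbove 0 w) (has011 w) = afterZeros-correct k w
afterZeros-correct k (suc zero ∷ w)
  rewrite ∨-regroup false (elemᵇ 1 w) (repeatsAbove 0 w) (repeatsAbove 1 w) (has011 w)
            (repeatsAbove⇒repeatsAbove-0 1 w)
  = afterAscent-correct 0 k w
afterZeros-correct k (suc (suc x) ∷ w) = refl

avoider-correct : ∀ k w → isCatalan w ∧ avoids w p011 ∧ (descents w ≡ᵇ k) ≡ avoider k w
avoider-correct k [] = refl
avoider-correct k (zero ∷ w) rewrite contains-011 (zero ∷ w) = afterZeros-correct k w
avoider-correct k (suc x ∷ w) = refl

countᵇ-++ : ∀ {A : Set} (f : A → Bool) xs ys → countᵇ f (xs ++ ys) ≡ countᵇ f xs + countᵇ f ys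
countᵇ-++ f [] ys = refl
countᵇ-++ f (x ∷ xs) ys
  rewrite countᵇ-++ f xs ys = sym (+-assoc (if f x then 1 else 0) (countᵇ f xs) (countᵇ f ys))

countᵇ-map : ∀ {A B : Set} (f : B → Bool) (g : A → B) xs → countᵇ f (map g xs) ≡ countᵇ (f ∘ g) xs
countᵇ-map f g [] = refl
countᵇ-map f g (x ∷ xs) rewrite countᵇ-map f g xs = refl

countᵇ-cong : ∀ {A : Set} {f g : A → Bool} → (∀ x → f x ≡ g x) → ∀ xs → countᵇ f xs ≡ countᵇ g xs
countᵇ-cong f≗g [] = refl
countᵇ-cong f≗g (x ∷ xs) rewrite f≗g x | countᵇ-cong f≗g xs = refl

countᵇ-const-false : ∀ {A : Set} (xs : List A) → countᵇ (λ _ → false) xs ≡ 0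
countᵇ-const-false [] = refl
countᵇ-const-false (_ ∷ xs) = countᵇ-const-false xs

sum-applyUpTo-zero : ∀ b (h : ℕ → ℕ) → (∀ a → h a ≡ 0) → sum (applyUpTo h b) ≡ 0
sum-applyUpTo-zero zero h _ = refl
sum-applyUpTo-zero (suc b) h h≡0 rewrite h≡0 0 = sum-applyUpTo-zero b (h ∘ suc) (h≡0 ∘ suc)

sum-applyUpTo-single : ∀ b c (h : ℕ → ℕ) → c < b → (∀ a → a ≢ c → h a ≡ 0) →
  sum (applyUpTo h b) ≡ h c
sum-applyUpTo-single (suc b) zero h _ h≡0
  rewrite sum-applyUpTo-zero b (h ∘ suc) (λ a → h≡0 (suc a) (λ ())) = +-identityʳ (h 0)
sum-applyUpTo-single (suc b) (suc c) h (s≤s c<b) h≡0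
  rewrite h≡0 0 (λ ()) = sum-applyUpTo-single b c (h ∘ suc) c<b (λ a a≢c → h≡0 (suc a) (a≢c ∘ cong pred))

countᵇ-prepend-each : ∀ (f : List ℕ → Bool) L b (g : ℕ → ℕ) →
  countᵇ f (concatMap (λ a → map (a ∷_) L) (applyUpTo g b))
  ≡ sum (applyUpTo (λ a → countᵇ (f ∘ (g a ∷_)) L) b)
countᵇ-prepend-each f L zero g = refl
countᵇ-prepend-each f L (suc b) g
  rewrite countᵇ-++ f (map (g 0 ∷_) L) (concatMap (λ a → map (a ∷_) L) (applyUpTo (g ∘ suc) b))
        | countᵇ-map f (g 0 ∷_) L | countᵇ-prepend-each f L b (g ∘ suc) = refl

countᵇ-wordsOver-suc : ∀ (f : List ℕ → Bool) b n →
  countᵇ f (wordsOver b (suc n)) ≡ sum (applyUpTo (λ a → countᵇ (f ∘ (a ∷_)) (wordsOver b n)) b)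
countᵇ-wordsOver-suc f b n = countᵇ-prepend-each f (wordsOver b n) b (λ a → a)

choose₂ : ℕ → ℕ
choose₂ zero = 0
choose₂ (suc r) = choose₂ r + r

#afterDrop : ℕ → ℕ
#afterDrop k = if 1 ≡ᵇ k then 1 else 0

#afterAscent : ℕ → ℕ → ℕ
#afterAscent zero r = 1
#afterAscent (suc zero) r = r
#afterAscent (suc (suc _)) r = 0

#afterZeros : ℕ → ℕ → ℕ
#afterZeros zero r = suc r
#afterZeros (suc zero) r = choose₂ r
#afterZeros (suc (suc _)) r = 0

#avoider : ℕ → ℕ → ℕ
#avoider zero zero = 1
#avoider zero (suc _) = 0
#avoider (suc r) k = #afterZeros k r

count-afterDrop : ∀ b k r → countᵇ (afterDrop k) (wordsOver (suc b) r) ≡ #afterDrop k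
count-afterDrop b k zero = +-identityʳ (#afterDrop k)
count-afterDrop b k (suc r)
  rewrite countᵇ-wordsOver-suc (afterDrop k) (suc b) r
        | sum-applyUpTo-zero b _ (λ _ → countᵇ-const-false (wordsOver (suc b) r))
        | count-afterDrop b k r
  = +-identityʳ (#afterDrop k)

countᵇ-afterAscent-wrong-letter : ∀ m k a → a ≢ m → ∀ ws → countᵇ (afterAscent m k ∘ (suc a ∷_)) ws ≡ 0
countᵇ-afterAscent-wrong-letter m k a a≢m ws rewrite ≢⇒≡ᵇ≡false a≢m = countᵇ-const-false ws

-- The bound keeps the letters m+2, …, m+1+r still to be climbed inside the alphabet {0,…,b}.
count-afterAscent : ∀ b m k r → suc m + r ≤ b →
  countᵇ (afterAscent (suc m) k) (wordsOver (suc b) r) ≡ #afterAscent k r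
count-afterAscent b m k zero _ = base k
  where
  base : ∀ k → (if 0 ≡ᵇ k then 1 else 0) + 0 ≡ #afterAscent k 0
  base zero = refl
  base (suc zero) = refl
  base (suc (suc k)) = refl
count-afterAscent b m k (suc r) m+r<b
  rewrite countᵇ-wordsOver-suc (afterAscent (suc m) k) (suc b) r
        | count-afterDrop b k r
        | sum-applyUpTo-single b (suc m) (λ a → countᵇ (afterAscent (suc m) k ∘ (suc a ∷_)) (wordsOver (suc b) r))
            (≤-trans (s≤s (s≤s (m≤m+n m r))) (subst (_≤ b) (cong suc (+-suc m r)) m+r<b))
            (λ a a≢m → countᵇ-afterAscent-wrong-letter (suc m) k a a≢m (wordsOver (suc b) r))
        | ≡ᵇ-refl (suc m)
        | count-afterAscent b (suc m) k r (subst (_≤ b) (+-suc (suc m) r) m+r<b)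
  = step k
  where
  step : ∀ k → #afterDrop k + #afterAscent k r ≡ #afterAscent k (suc r)
  step zero = refl
  step (suc zero) = refl
  step (suc (suc k)) = refl

count-afterZeros : ∀ b k r → r ≤ b → countᵇ (afterZeros k) (wordsOver (suc b) r) ≡ #afterZeros k r
count-afterZeros b k zero _ = base k
  where
  base : ∀ k → (if 0 ≡ᵇ k then 1 else 0) + 0 ≡ #afterZeros k 0
  base zero = refl
  base (suc zero) = refl
  base (suc (suc k)) = refl
count-afterZeros (suc b) k (suc r) (s≤s r≤b)
  rewrite countᵇ-wordsOver-suc (afterZeros k) (suc (suc b)) r
        | sum-applyUpTo-zero b _ (λ _ → countᵇ-const-false (wordsOver (suc (suc b)) r))
        | count-afterZeros (suc b) k r (≤-trans r≤b (n≤1+n b))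
        | count-afterAscent (suc b) 0 k r (s≤s r≤b)
        | +-identityʳ (#afterAscent k r)
  = step k
  where
  step : ∀ k → #afterZeros k r + #afterAscent k r ≡ #afterZeros k (suc r)
  step zero = +-comm (suc r) 1
  step (suc zero) = refl
  step (suc (suc k)) = refl

count-avoider : ∀ n k → countᵇ (avoider k) (wordsOver n n) ≡ #avoider n k
count-avoider zero zero = refl
count-avoider zero (suc k) = refl
count-avoider (suc r) k
  rewrite countᵇ-wordsOver-suc (avoider k) (suc r) r
        | sum-applyUpTo-zero r _ (λ _ → countᵇ-const-false (wordsOver (suc r) r))
        | count-afterZeros r k r ≤-refl
  = +-identityʳ (#afterZeros k r)

cnk-011 : ∀ n k → cnk p011 n k ≡ #avoider n k
cnk-011 n k = trans (countᵇ-cong (avoider-correct k) (wordsOver n n)) (count-avoider n k)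

shiftX-cong : ∀ {F G : Series} → (∀ n k → F n k ≡ G n k) → ∀ j n k → shiftX j F n k ≡ shiftX j G n k
shiftX-cong F≗G j n k with j ≤ᵇ n
... | true = F≗G (n ∸ j) k
... | false = refl

times1mx³-cong : ∀ {F G : Series} → (∀ n k → F n k ≡ G n k) → ∀ n k → times1mx³ F n k ≡ times1mx³ G n k
times1mx³-cong F≗G n k
  rewrite F≗G n k | shiftX-cong F≗G 1 n k | shiftX-cong F≗G 2 n k | shiftX-cong F≗G 3 n k = refl

third-difference≡0 : ∀ a b c d → a + 3 * c ≡ 3 * b + d →
  + a - + 3 *ℤ + b +ℤ + 3 *ℤ + c - + d ≡ + 0
third-difference≡0 a b c d a+3c≡3b+d = begin
    + a - + 3 *ℤ + b +ℤ + 3 *ℤ + c - + d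
  ≡⟨ solve 4 (λ A B C D → A :- con (+ 3) :* B :+ con (+ 3) :* C :- D
                         := (A :+ con (+ 3) :* C) :- (con (+ 3) :* B :+ D)) refl (+ a) (+ b) (+ c) (+ d) ⟩
    (+ a +ℤ + 3 *ℤ + c) - (+ 3 *ℤ + b +ℤ + d)
  ≡⟨ cong₂ _-_ (trans (cong (+ a +ℤ_) (sym (pos-* 3 c))) (sym (pos-+ a (3 * c))))
               (trans (cong (_+ℤ + d) (sym (pos-* 3 b))) (sym (pos-+ (3 * b) d))) ⟩
    + (a + 3 * c) - + (3 * b + d)
  ≡⟨ cong (λ t → + (a + 3 * c) - + t) (sym a+3c≡3b+d) ⟩
    + (a + 3 * c) - + (a + 3 * c)
  ≡⟨ +-inverseʳ (+ (a + 3 * c)) ⟩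
    + 0 ∎
  where
  open ≡-Reasoning
  open +-*-Solver

times1mx³-#avoider : ∀ n k → times1mx³ (λ n k → + #avoider n k) n k ≡ numer n k
times1mx³-#avoider 0 0 = refl
times1mx³-#avoider 0 (suc k) = refl
times1mx³-#avoider 1 0 = refl
times1mx³-#avoider 1 1 = refl
times1mx³-#avoider 1 (suc (suc k)) = refl
times1mx³-#avoider 2 0 = refl
times1mx³-#avoider 2 1 = refl
times1mx³-#avoider 2 (suc (suc k)) = refl
times1mx³-#avoider 3 0 = refl
times1mx³-#avoider 3 1 = refl
times1mx³-#avoider 3 (suc (suc k)) = refl
times1mx³-#avoider (suc (suc (suc (suc m)))) 0 =
  third-difference≡0 (4 + m) (3 + m) (2 + m) (1 + m)
    (solve 1 (λ m → (con 4 :+ m) :+ con 3 :* (con 2 :+ m) := con 3 :* (con 3 :+ m) :+ (con 1 :+ m)) refl m)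
  where open ℕ-Solver.+-*-Solver
times1mx³-#avoider (suc (suc (suc (suc m)))) 1 =
  third-difference≡0 (choose₂ (3 + m)) (choose₂ (2 + m)) (choose₂ (1 + m)) (choose₂ m)
    (solve 2 (λ t m → (((t :+ m) :+ (con 1 :+ m)) :+ (con 2 :+ m)) :+ con 3 :* (t :+ m)
                   := con 3 :* ((t :+ m) :+ (con 1 :+ m)) :+ t) refl (choose₂ m) m)
  where open ℕ-Solver.+-*-Solver
times1mx³-#avoider (suc (suc (suc (suc m)))) (suc (suc k)) = refl

theorem9 : ∀ (n k : ℕ) → times1mx³ (Cgf p011) n k ≡ numer n k
theorem9 n k = begin
  times1mx³ (Cgf p011) n k                   ≡⟨ times1mx³-cong (λ n k → cong +_ (cnk-011 n k)) n k ⟩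
  times1mx³ (λ n k → + #avoider n k) n k    ≡⟨ times1mx³-#avoider n k ⟩
  numer n k                                  ∎
  where open ≡-Reasoning
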